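{- Let $q>2$ be a prime power. Then every permutation of $\mathbb{F}_q$ is induced by a polynomial $f\in\mathbb{F}_q[x]$ which permutes $\mathbb{F}_{q^k}$ for infinitely many positive integers $k$ (that is, every permutation of $\mathbb{F}_q$ is induced by an exceptional polynomial).
   Context: A polynomial $f\in\mathbb{F}_q[x]$ induces the map $\mathbb{F}_q\to\mathbb{F}_q$, $c\mapsto f(c)$; it permutes $\mathbb{F}_{q^k}$ if the map $c\mapsto f(c)$ is a bijection of $\mathbb{F}_{q^k}$. A polynomial over $\mathbb{F}_q$ is called exceptional if it permutes $\mathbb{F}_{q^k}$ for infinitely many $k$. -}

module Defs where

open import Level using (0ℓ)
open import Data.Nat using (ℕ; _^_)
open import Data.Fin using (Fin)
open import Data.List using (List; []; _∷_; map)
open import Data.Product using (Σ; _×_)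
open import Relation.Binary.PropositionalEquality using (_≡_)
open import Relation.Nullary using (¬_)
open import Algebra.Structures using (IsCommutativeRing)
open import Function.Bundles using (_↔_)

record Field : Set₁ where
  field
    Carrier : Set
    _+_ _*_ : Carrier → Carrier → Carrier
    -_      : Carrier → Carrier
    0# 1#   : Carrier
    isCommutativeRing : IsCommutativeRing _≡_ _+_ _*_ -_ 0# 1#
    0≢1     : ¬ (0# ≡ 1#)
    inverse : (x : Carrier) → ¬ (x ≡ 0#) → Σ Carrier (λ y → (x * y) ≡ 1#)

record FiniteField (n : ℕ) : Set₁ where
  field
    field′   : Field
    enumerate : Field.Carrier field′ ↔ Fin n
  open Field field′ public

-- Polynomials as coefficient lists, lowest degree first.
Poly : Field → Set
Poly K = List (Field.Carrier K)

eval : (K : Field) → Poly K → Field.Carrier K → Field.Carrier K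
eval K []       x = Field.0# K
eval K (a ∷ as) x = Field._+_ K a (Field._*_ K x (eval K as x))

-- Field homomorphism (embedding K ↪ L, making L an extension of K).
record IsFieldHom (K L : Field) (φ : Field.Carrier K → Field.Carrier L) : Set where
  field
    φ-+ : ∀ x y → φ (Field._+_ K x y) ≡ Field._+_ L (φ x) (φ y)
    φ-* : ∀ x y → φ (Field._*_ K x y) ≡ Field._*_ L (φ x) (φ y)
    φ-1 : φ (Field.1# K) ≡ Field.1# L

mapPoly : (K L : Field) → (Field.Carrier K → Field.Carrier L) → Poly K → Poly L
mapPoly K L φ = map φ

module Submission where

-- Write q = r + 2 and e = 1 + q + ... + q^(r-1).  Then e ≡ -1 (mod q - 1), so
-- x^e induces inversion c ↦ c⁻¹ (0 ↦ 0) on K, while e is coprime to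
-- q^(1+tr) - 1 for every t, so x^e is injective on every field of that size.
-- Call a map of K *good* if it is induced by a polynomial injective on all
-- fields of size q^(1+tr) containing K.  Good maps contain the affine maps and
-- x^e and are closed under composition.  Carlitz's identity says that
-- c ↦ 1 - c⁻¹, iterated three times, is the transposition of 0 and 1; with
-- affine conjugation every transposition is good, and since every
-- permutation is a product of transpositions, every permutation is good.
-- Injective maps of a finite set are bijective, which gives the theorem.

open import Defs
open import Data.Nat using (ℕ; _^_; _<_)
open import Data.Nat.Primality using (Prime)
open import Data.Product using (Σ; ∃; _×_)
open import Function.Definitions using (Bijective)
open import Relation.Binary.PropositionalEquality using (_≡_)

open import Level using (0ℓ)
open import Data.Nat as ℕ using (zero; suc; _∸_; _≤_; s≤s)
import Data.Nat.Properties as ℕₚ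
open import Data.Nat.Divisibility using (_∣_; ∣1⇒≡1; ∣m+n∣m⇒∣n; ∣m⇒∣m*n)
open import Data.Nat.Coprimality using (Coprime; coprime-Bézout)
open import Data.Nat.GCD using (module Bézout)
open import Data.Nat.Tactic.RingSolver using (solve-∀)
open import Data.Fin as Fin using (Fin; punchIn; punchOut)
import Data.Fin.Properties as Finₚ
open import Data.Fin.Permutation using (Permutation′; permutation; _⟨$⟩ʳ_; transpose; _∘ₚ_)
import Data.Fin.Permutation.Components as PermutationComponents
import Data.Fin.Permutation.Transposition.List as Transpositions
open import Data.List using ([]; _∷_; map)
open import Data.Product using (_,_; proj₁; proj₂)
open import Data.Empty using (⊥-elim)
open import Relation.Nullary using (Dec; yes; no)
open import Relation.Nullary.Decidable using (map′)
open import Relation.Binary.PropositionalEquality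
  using (_≢_; refl; sym; trans; cong; cong₂; subst; module ≡-Reasoning)
open import Function.Bundles using (Inverse)
open import Function.Definitions using (Injective; Surjective)
open import Algebra.Bundles using (CommutativeRing)

-- Pigeonhole: an injective endomap of Fin n is surjective.  If y were
-- missed, punching y out of the range would inject Fin n into Fin (n - 1).
injective⇒surjective-Fin : ∀ {n} (g : Fin n → Fin n) → Injective _≡_ _≡_ g →
  ∀ y → ∃ λ i → g i ≡ y
injective⇒surjective-Fin {suc m} g g-inj y with Finₚ.any? (λ i → g i Finₚ.≟ y)
... | yes hit = hit
... | no miss = ⊥-elim (ℕₚ.<-irrefl refl (Finₚ.injective⇒≤ squeeze-injective))
  where
    squeeze : Fin (suc m) → Fin m
    squeeze i = punchOut {i = y} {j = g i} (λ y≡gi → miss (i , sym y≡gi))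
    squeeze-injective : Injective _≡_ _≡_ squeeze
    squeeze-injective {i} {j} eq = g-inj (Finₚ.punchOut-injective
      (λ y≡gi → miss (i , sym y≡gi)) (λ y≡gj → miss (j , sym y≡gj)) eq)

module _ {n : ℕ} (i j : Fin n) where
  open PermutationComponents using () renaming (transpose to swapFin)

  swapFin-left : swapFin i j i ≡ j
  swapFin-left with i Finₚ.≟ i
  ... | yes _ = refl
  ... | no i≢i = ⊥-elim (i≢i refl)

  swapFin-right : swapFin i j j ≡ i
  swapFin-right with j Finₚ.≟ i
  ... | yes j≡i = j≡i
  ... | no _ with j Finₚ.≟ j
  ...   | yes _ = refl
  ...   | no j≢j = ⊥-elim (j≢j refl)

  swapFin-other : ∀ {k} → k ≢ i → k ≢ j → swapFin i j k ≡ k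
  swapFin-other {k} k≢i k≢j with k Finₚ.≟ i
  ... | yes k≡i = ⊥-elim (k≢i k≡i)
  ... | no _ with k Finₚ.≟ j
  ...   | yes k≡j = ⊥-elim (k≢j k≡j)
  ...   | no _ = refl

module FieldArithmetic (F : Field) where
  open Field F public using (Carrier; inverse)

  ring : CommutativeRing 0ℓ 0ℓ
  ring = record { isCommutativeRing = Field.isCommutativeRing F }

  open CommutativeRing ring public
    using ( _+_; _*_; -_; _-_; 0#; 1#; +-identityˡ; +-identityʳ; *-identityˡ; *-identityʳ
          ; zeroˡ; zeroʳ; -‿inverseˡ; -‿inverseʳ; +-assoc; *-assoc; +-comm; *-comm
          ; distribʳ; commutativeSemiring )
  open import Algebra.Properties.Ring (CommutativeRing.ring ring) public
    using (+-cancelˡ; -‿involutive; -1*x≈-x; -0#≈0#; -‿distribˡ-*; x[y-z]≈xy-xz; x∙y⁻¹≈ε⇒x≈y; ⁻¹-anti-homo‿-)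
  open import Algebra.Properties.Semiring.Exp (CommutativeRing.semiring ring) public
    using (^-assocʳ) renaming (_^_ to _^ᶠ_)

  1≢0 : 1# ≢ 0#
  1≢0 1≡0 = Field.0≢1 F (sym 1≡0)

  *-cancelˡ-nonzero : ∀ {a x y} → a ≢ 0# → a * x ≡ a * y → x ≡ y
  *-cancelˡ-nonzero {a} {x} {y} a≢0 ax≡ay = begin
      x              ≡⟨ sym (*-identityˡ x) ⟩
      1# * x         ≡⟨ cong (_* x) (sym a⁻¹a) ⟩
      (a⁻¹ * a) * x  ≡⟨ *-assoc a⁻¹ a x ⟩
      a⁻¹ * (a * x)  ≡⟨ cong (a⁻¹ *_) ax≡ay ⟩
      a⁻¹ * (a * y)  ≡⟨ sym (*-assoc a⁻¹ a y) ⟩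
      (a⁻¹ * a) * y  ≡⟨ cong (_* y) a⁻¹a ⟩
      1# * y         ≡⟨ *-identityˡ y ⟩
      y              ∎
    where
      open ≡-Reasoning
      a⁻¹ : Carrier
      a⁻¹ = proj₁ (inverse a a≢0)
      a⁻¹a : a⁻¹ * a ≡ 1#
      a⁻¹a = trans (*-comm a⁻¹ a) (proj₂ (inverse a a≢0))

  *-cancelʳ-nonzero : ∀ {a x y} → a ≢ 0# → x * a ≡ y * a → x ≡ y
  *-cancelʳ-nonzero {a} {x} {y} a≢0 xa≡ya =
    *-cancelˡ-nonzero a≢0 (trans (*-comm a x) (trans xa≡ya (*-comm y a)))

  invertible-left : ∀ {a x} → a * x ≡ 1# → a ≢ 0#
  invertible-left {a} {x} ax≡1 a≡0 = 1≢0 (trans (sym ax≡1) (trans (cong (_* x) a≡0) (zeroˡ x)))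

  invertible-right : ∀ {a x} → a * x ≡ 1# → x ≢ 0#
  invertible-right {a} {x} ax≡1 = invertible-left (trans (*-comm x a) ax≡1)

  *-nonzero : ∀ {a b} → a ≢ 0# → b ≢ 0# → a * b ≢ 0#
  *-nonzero {a} {b} a≢0 b≢0 ab≡0 = b≢0 (*-cancelˡ-nonzero a≢0 (trans ab≡0 (sym (zeroʳ a))))

  inverse-unique : ∀ {a x y} → a * x ≡ 1# → a * y ≡ 1# → x ≡ y
  inverse-unique ax≡1 ay≡1 = *-cancelˡ-nonzero (invertible-left ax≡1) (trans ax≡1 (sym ay≡1))

  ^-nonzero : ∀ {a} n → a ≢ 0# → a ^ᶠ n ≢ 0#
  ^-nonzero zero    a≢0 = 1≢0
  ^-nonzero (suc n) a≢0 = *-nonzero a≢0 (^-nonzero n a≢0)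

  1^n≡1 : ∀ n → 1# ^ᶠ n ≡ 1#
  1^n≡1 zero    = refl
  1^n≡1 (suc n) = trans (*-identityˡ _) (1^n≡1 n)

  sub-sub : ∀ a b → a - (a - b) ≡ b
  sub-sub a b = begin
      a + - (a + - b)  ≡⟨ cong (a +_) (⁻¹-anti-homo‿- a b) ⟩
      a + (b + - a)    ≡⟨ cong (a +_) (+-comm b (- a)) ⟩
      a + (- a + b)    ≡⟨ sym (+-assoc a (- a) b) ⟩
      (a + - a) + b    ≡⟨ cong (_+ b) (-‿inverseʳ a) ⟩
      0# + b           ≡⟨ +-identityˡ b ⟩
      b                ∎
    where open ≡-Reasoning

module Polynomials (F : Field) where
  open FieldArithmetic F
  open import Algebra.Solver.Ring.NaturalCoefficients.Default commutativeSemiring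
    using (solve; _:=_; _:+_; _:*_)

  ⟦_⟧ : Poly F → Carrier → Carrier
  ⟦_⟧ = eval F

  infixl 6 _⊕_
  infixl 7 _⊛_
  infixr 9 _⊚_

  _⊕_ : Poly F → Poly F → Poly F
  []      ⊕ g       = g
  (a ∷ f) ⊕ []      = a ∷ f
  (a ∷ f) ⊕ (b ∷ g) = (a + b) ∷ (f ⊕ g)

  scale : Carrier → Poly F → Poly F
  scale a = map (a *_)

  _⊛_ : Poly F → Poly F → Poly F
  []      ⊛ g = []
  (a ∷ f) ⊛ g = scale a g ⊕ (0# ∷ f ⊛ g)

  _⊚_ : Poly F → Poly F → Poly F
  []      ⊚ g = []
  (a ∷ f) ⊚ g = (a ∷ []) ⊕ g ⊛ (f ⊚ g)

  monomial : ℕ → Poly F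
  monomial zero    = 1# ∷ []
  monomial (suc n) = 0# ∷ monomial n

  eval-⊕ : ∀ f g x → ⟦ f ⊕ g ⟧ x ≡ ⟦ f ⟧ x + ⟦ g ⟧ x
  eval-⊕ []      g       x = sym (+-identityˡ _)
  eval-⊕ (a ∷ f) []      x = sym (+-identityʳ _)
  eval-⊕ (a ∷ f) (b ∷ g) x =
    trans (cong (λ s → (a + b) + x * s) (eval-⊕ f g x)) (regroup a b x (⟦ f ⟧ x) (⟦ g ⟧ x))
    where
      regroup : ∀ a b x u v → (a + b) + x * (u + v) ≡ (a + x * u) + (b + x * v)
      regroup = solve 5 (λ a b x u v → (a :+ b) :+ x :* (u :+ v) := (a :+ x :* u) :+ (b :+ x :* v)) refl

  eval-scale : ∀ a g x → ⟦ scale a g ⟧ x ≡ a * ⟦ g ⟧ x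
  eval-scale a []      x = sym (zeroʳ a)
  eval-scale a (b ∷ g) x =
    trans (cong (λ s → a * b + x * s) (eval-scale a g x)) (factor a b x (⟦ g ⟧ x))
    where
      factor : ∀ a b x u → a * b + x * (a * u) ≡ a * (b + x * u)
      factor = solve 4 (λ a b x u → a :* b :+ x :* (a :* u) := a :* (b :+ x :* u)) refl

  eval-⊛ : ∀ f g x → ⟦ f ⊛ g ⟧ x ≡ ⟦ f ⟧ x * ⟦ g ⟧ x
  eval-⊛ []      g x = sym (zeroˡ _)
  eval-⊛ (a ∷ f) g x = begin
      ⟦ scale a g ⊕ (0# ∷ f ⊛ g) ⟧ x            ≡⟨ eval-⊕ (scale a g) (0# ∷ f ⊛ g) x ⟩
      ⟦ scale a g ⟧ x + (0# + x * ⟦ f ⊛ g ⟧ x)  ≡⟨ cong₂ _+_ (eval-scale a g x) (+-identityˡ _) ⟩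
      a * ⟦ g ⟧ x + x * ⟦ f ⊛ g ⟧ x             ≡⟨ cong (λ s → a * ⟦ g ⟧ x + x * s) (eval-⊛ f g x) ⟩
      a * ⟦ g ⟧ x + x * (⟦ f ⟧ x * ⟦ g ⟧ x)     ≡⟨ factor a x (⟦ f ⟧ x) (⟦ g ⟧ x) ⟩
      (a + x * ⟦ f ⟧ x) * ⟦ g ⟧ x               ∎
    where
      open ≡-Reasoning
      factor : ∀ a x u v → a * v + x * (u * v) ≡ (a + x * u) * v
      factor = solve 4 (λ a x u v → a :* v :+ x :* (u :* v) := (a :+ x :* u) :* v) refl

  eval-const : ∀ a x → ⟦ a ∷ [] ⟧ x ≡ a
  eval-const a x = trans (cong (a +_) (zeroʳ x)) (+-identityʳ a)

  eval-⊚ : ∀ f g x → ⟦ f ⊚ g ⟧ x ≡ ⟦ f ⟧ (⟦ g ⟧ x)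
  eval-⊚ []      g x = refl
  eval-⊚ (a ∷ f) g x = begin
      ⟦ (a ∷ []) ⊕ g ⊛ (f ⊚ g) ⟧ x        ≡⟨ eval-⊕ (a ∷ []) (g ⊛ (f ⊚ g)) x ⟩
      ⟦ a ∷ [] ⟧ x + ⟦ g ⊛ (f ⊚ g) ⟧ x    ≡⟨ cong₂ _+_ (eval-const a x) (eval-⊛ g (f ⊚ g) x) ⟩
      a + ⟦ g ⟧ x * ⟦ f ⊚ g ⟧ x           ≡⟨ cong (λ s → a + ⟦ g ⟧ x * s) (eval-⊚ f g x) ⟩
      a + ⟦ g ⟧ x * ⟦ f ⟧ (⟦ g ⟧ x)       ∎
    where open ≡-Reasoning

  eval-monomial : ∀ n x → ⟦ monomial n ⟧ x ≡ x ^ᶠ n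
  eval-monomial zero    x = eval-const 1# x
  eval-monomial (suc n) x = trans (+-identityˡ _) (cong (x *_) (eval-monomial n x))

  eval-linear : ∀ β α x → ⟦ β ∷ α ∷ [] ⟧ x ≡ β + x * α
  eval-linear β α x = cong (λ s → β + x * s) (eval-const α x)

module PolynomialsUnderEmbedding (K L : Field) (φ : Field.Carrier K → Field.Carrier L)
                                 (φ-hom : IsFieldHom K L φ) where
  private
    module K = FieldArithmetic K
    module L = FieldArithmetic L
    module PK = Polynomials K
    module PL = Polynomials L
  open IsFieldHom φ-hom

  φ-0 : φ K.0# ≡ L.0#
  φ-0 = L.+-cancelˡ (φ K.0#) (φ K.0#) L.0# (begin
      φ K.0# L.+ φ K.0#  ≡⟨ sym (φ-+ K.0# K.0#) ⟩
      φ (K.0# K.+ K.0#)  ≡⟨ cong φ (K.+-identityʳ K.0#) ⟩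
      φ K.0#             ≡⟨ sym (L.+-identityʳ _) ⟩
      φ K.0# L.+ L.0#    ∎)
    where open ≡-Reasoning

  φ-nonzero : ∀ {a} → a ≢ K.0# → φ a ≢ L.0#
  φ-nonzero {a} a≢0 = L.invertible-left (begin
      φ a L.* φ a⁻¹   ≡⟨ sym (φ-* a a⁻¹) ⟩
      φ (a K.* a⁻¹)   ≡⟨ cong φ (proj₂ (K.inverse a a≢0)) ⟩
      φ K.1#          ≡⟨ φ-1 ⟩
      L.1#            ∎)
    where
      open ≡-Reasoning
      a⁻¹ : K.Carrier
      a⁻¹ = proj₁ (K.inverse a a≢0)

  φ* : Poly K → Poly L
  φ* = mapPoly K L φ

  map-⊕ : ∀ f g → φ* (f PK.⊕ g) ≡ φ* f PL.⊕ φ* g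
  map-⊕ []      g       = refl
  map-⊕ (a ∷ f) []      = refl
  map-⊕ (a ∷ f) (b ∷ g) = cong₂ _∷_ (φ-+ a b) (map-⊕ f g)

  map-scale : ∀ a g → φ* (PK.scale a g) ≡ PL.scale (φ a) (φ* g)
  map-scale a []      = refl
  map-scale a (b ∷ g) = cong₂ _∷_ (φ-* a b) (map-scale a g)

  map-⊛ : ∀ f g → φ* (f PK.⊛ g) ≡ φ* f PL.⊛ φ* g
  map-⊛ []      g = refl
  map-⊛ (a ∷ f) g = trans (map-⊕ (PK.scale a g) (K.0# ∷ f PK.⊛ g))
    (cong₂ PL._⊕_ (map-scale a g) (cong₂ _∷_ φ-0 (map-⊛ f g)))

  map-⊚ : ∀ f g → φ* (f PK.⊚ g) ≡ φ* f PL.⊚ φ* g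
  map-⊚ []      g = refl
  map-⊚ (a ∷ f) g = trans (map-⊕ (a ∷ []) (g PK.⊛ (f PK.⊚ g)))
    (cong ((φ a ∷ []) PL.⊕_) (trans (map-⊛ g (f PK.⊚ g)) (cong (φ* g PL.⊛_) (map-⊚ f g))))

  map-monomial : ∀ n → φ* (PK.monomial n) ≡ PL.monomial n
  map-monomial zero    = cong (_∷ []) φ-1
  map-monomial (suc n) = cong₂ _∷_ φ-0 (map-monomial n)

  eval-map-⊚ : ∀ f g y → PL.⟦ φ* (f PK.⊚ g) ⟧ y ≡ PL.⟦ φ* f ⟧ (PL.⟦ φ* g ⟧ y)
  eval-map-⊚ f g y = trans (cong (λ h → PL.⟦ h ⟧ y) (map-⊚ f g)) (PL.eval-⊚ (φ* f) (φ* g) y)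

  eval-map-monomial : ∀ n y → PL.⟦ φ* (PK.monomial n) ⟧ y ≡ y L.^ᶠ n
  eval-map-monomial n y = trans (cong (λ h → PL.⟦ h ⟧ y) (map-monomial n)) (PL.eval-monomial n y)

module FiniteFieldFacts {n : ℕ} (K : FiniteField n) where
  open FieldArithmetic (FiniteField.field′ K)
  open Inverse (FiniteField.enumerate K) public
    using (to; from) renaming (strictlyInverseˡ to to-from; strictlyInverseʳ to from-to)

  to-injective : ∀ {x y} → to x ≡ to y → x ≡ y
  to-injective {x} {y} eq = trans (sym (from-to x)) (trans (cong from eq) (from-to y))

  infix 4 _≟_
  _≟_ : (x y : Carrier) → Dec (x ≡ y)
  x ≟ y = map′ to-injective (cong to) (to x Finₚ.≟ to y)

  injective⇒bijective : (f : Carrier → Carrier) → Injective _≡_ _≡_ f → Bijective _≡_ _≡_ f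
  injective⇒bijective f f-inj = f-inj , surjective
    where
      f-on-indices : Fin n → Fin n
      f-on-indices i = to (f (from i))
      f-on-indices-injective : Injective _≡_ _≡_ f-on-indices
      f-on-indices-injective {i} {j} eq =
        trans (sym (to-from i)) (trans (cong to (f-inj (to-injective eq))) (to-from j))
      surjective : Surjective _≡_ _≡_ f
      surjective y with injective⇒surjective-Fin f-on-indices f-on-indices-injective (to y)
      ... | i , fi≡y = from i , λ { refl → to-injective fi≡y }

  asPermutation : (f g : Carrier → Carrier) → (∀ x → f (g x) ≡ x) → (∀ x → g (f x) ≡ x) →
    Permutation′ n
  asPermutation f g fg≡id gf≡id =
    permutation (λ i → to (f (from i))) (λ i → to (g (from i))) (back f g fg≡id) (back g f gf≡id)
    where
      back : (f g : Carrier → Carrier) → (∀ x → f (g x) ≡ x) → ∀ i → to (f (from (to (g (from i))))) ≡ i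
      back f g fg≡id i = trans (cong (λ x → to (f x)) (from-to _)) (trans (cong to (fg≡id (from i))) (to-from i))

  induced : Permutation′ n → Carrier → Carrier
  induced π c = from (π ⟨$⟩ʳ to c)

  induced-∘ : ∀ π ρ c → induced (π ∘ₚ ρ) c ≡ induced ρ (induced π c)
  induced-∘ π ρ c = cong (λ i → from (ρ ⟨$⟩ʳ i)) (sym (to-from _))

  swap : Carrier → Carrier → Carrier → Carrier
  swap a b = induced (transpose (to a) (to b))

  swap-left : ∀ a b → swap a b a ≡ b
  swap-left a b = trans (cong from (swapFin-left (to a) (to b))) (from-to b)

  swap-right : ∀ a b → swap a b b ≡ a
  swap-right a b = trans (cong from (swapFin-right (to a) (to b))) (from-to a)

  swap-other : ∀ {a b c} → c ≢ a → c ≢ b → swap a b c ≡ c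
  swap-other {a} {b} {c} c≢a c≢b = trans
    (cong from (swapFin-other (to a) (to b) (λ eq → c≢a (to-injective eq)) (λ eq → c≢b (to-injective eq))))
    (from-to c)

  swap-trivial : ∀ {a b} → a ≡ b → ∀ c → c ≡ swap a b c
  swap-trivial {a} {b} a≡b c with c ≟ a
  ... | yes c≡a = sym (trans (cong (swap a b) c≡a) (trans (swap-left a b) (sym (trans c≡a a≡b))))
  ... | no c≢a  = sym (swap-other c≢a (λ c≡b → c≢a (trans c≡b (sym a≡b))))

  induced-transpose : ∀ i j c → induced (transpose i j) c ≡ swap (from i) (from j) c
  induced-transpose i j c =
    cong₂ (λ i′ j′ → from (transpose i′ j′ ⟨$⟩ʳ to c)) (sym (to-from i)) (sym (to-from j))

  open import Algebra.Properties.CommutativeMonoid.Sum (CommutativeRing.*-commutativeMonoid ring)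
    using (sum-remove; sum-permute; sum-cong-≗; ∑-distrib-+; sum-replicate) renaming (sum to ∏)

  ∏-nonzero : ∀ {k} (h : Fin k → Carrier) → (∀ i → h i ≢ 0#) → ∏ h ≢ 0#
  ∏-nonzero {zero}  h h≢0 = 1≢0
  ∏-nonzero {suc k} h h≢0 = *-nonzero (h≢0 Fin.zero) (∏-nonzero (λ i → h (Fin.suc i)) (λ i → h≢0 (Fin.suc i)))

  ∏-all-but-one : ∀ {k} (h : Fin k → Carrier) (i₀ : Fin k) {a} →
    h i₀ ≡ 1# → (∀ i → i ≢ i₀ → h i ≡ a) → ∏ h ≡ a ^ᶠ (k ∸ 1)
  ∏-all-but-one {suc k} h i₀ {a} hi₀≡1 hi≡a = begin
      ∏ h                                      ≡⟨ sum-remove {i = i₀} h ⟩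
      h i₀ * ∏ {k} (λ j → h (punchIn i₀ j))    ≡⟨ cong₂ _*_ hi₀≡1 (sum-cong-≗ λ j → hi≡a _ (Finₚ.punchInᵢ≢i i₀ j)) ⟩
      1# * ∏ {k} (λ _ → a)                     ≡⟨ *-identityˡ _ ⟩
      ∏ {k} (λ _ → a)                          ≡⟨ sum-replicate k ⟩
      a ^ᶠ k                                   ∎
    where open ≡-Reasoning

  ∏ᴷ : (Carrier → Carrier) → Carrier
  ∏ᴷ h = ∏ {n} (λ i → h (from i))

  ∏ᴷ-nonzero : ∀ h → (∀ z → h z ≢ 0#) → ∏ᴷ h ≢ 0#
  ∏ᴷ-nonzero h h≢0 = ∏-nonzero _ λ i → h≢0 (from i)

  ∏ᴷ-* : ∀ h k → ∏ᴷ (λ z → h z * k z) ≡ ∏ᴷ h * ∏ᴷ k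
  ∏ᴷ-* h k = ∑-distrib-+ (λ i → h (from i)) (λ i → k (from i))

  ∏ᴷ-reindex : ∀ h (f g : Carrier → Carrier) (fg≡id : ∀ x → f (g x) ≡ x) (gf≡id : ∀ x → g (f x) ≡ x) →
    ∏ᴷ h ≡ ∏ᴷ (λ z → h (f z))
  ∏ᴷ-reindex h f g fg≡id gf≡id = trans (sum-permute _ (asPermutation f g fg≡id gf≡id))
    (sum-cong-≗ {n} λ i → cong h (from-to _))

  ∏ᴷ-all-but-zero : ∀ h {a} → h 0# ≡ 1# → (∀ z → z ≢ 0# → h z ≡ a) → ∏ᴷ h ≡ a ^ᶠ (n ∸ 1)
  ∏ᴷ-all-but-zero h h0≡1 hz≡a = ∏-all-but-one _ (to 0#) (trans (cong h (from-to 0#)) h0≡1)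
    λ i i≢0 → hz≡a (from i) λ eq → i≢0 (trans (sym (to-from i)) (cong to eq))

  ifZero : Carrier → Carrier → Carrier → Carrier
  ifZero z t e with z ≟ 0#
  ... | yes _ = t
  ... | no _  = e

  ifZero-0 : ∀ {z t e} → z ≡ 0# → ifZero z t e ≡ t
  ifZero-0 {z} z≡0 with z ≟ 0#
  ... | yes _   = refl
  ... | no z≢0  = ⊥-elim (z≢0 z≡0)

  ifZero-≢ : ∀ {z t e} → z ≢ 0# → ifZero z t e ≡ e
  ifZero-≢ {z} z≢0 with z ≟ 0#
  ... | yes z≡0 = ⊥-elim (z≢0 z≡0)
  ... | no _    = refl

  -- With u(z) = z for z ≠ 0,
  -- u(0) = 1, and v(z) = a for z ≠ 0, v(0) = 1, we have u(a z) = v(z) u(z);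
  -- since z ↦ a z permutes the field, ∏ u = ∏ v · ∏ u, so a ^ (n - 1) = ∏ v = 1.
  module Fermat {a : Carrier} (a≢0 : a ≢ 0#) where
    u v : Carrier → Carrier
    u z = ifZero z 1# z
    v z = ifZero z 1# a

    u-nonzero : ∀ z → u z ≢ 0#
    u-nonzero z with z ≟ 0#
    ... | yes _   = 1≢0
    ... | no z≢0  = z≢0

    u-scaled : ∀ z → u (a * z) ≡ v z * u z
    u-scaled z with z ≟ 0# | a * z ≟ 0#
    ... | yes z≡0 | no az≢0 = ⊥-elim (az≢0 (trans (cong (a *_) z≡0) (zeroʳ a)))
    ... | yes _   | yes _   = sym (*-identityˡ 1#)
    ... | no z≢0  | yes az≡0 = ⊥-elim (*-nonzero a≢0 z≢0 az≡0)
    ... | no _    | no _    = refl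

    a⁻¹ : Carrier
    a⁻¹ = proj₁ (inverse a a≢0)

    cancel : ∀ {b c} → b * c ≡ 1# → ∀ x → b * (c * x) ≡ x
    cancel bc≡1 x = trans (sym (*-assoc _ _ x)) (trans (cong (_* x) bc≡1) (*-identityˡ x))

    ∏u≡∏v*∏u : ∏ᴷ u ≡ ∏ᴷ v * ∏ᴷ u
    ∏u≡∏v*∏u = begin
        ∏ᴷ u                        ≡⟨ ∏ᴷ-reindex u (a *_) (a⁻¹ *_) (cancel aa⁻¹) (cancel (trans (*-comm a⁻¹ a) aa⁻¹)) ⟩
        ∏ᴷ (λ z → u (a * z))        ≡⟨ sum-cong-≗ {n} (λ i → u-scaled (from i)) ⟩
        ∏ᴷ (λ z → v z * u z)        ≡⟨ ∏ᴷ-* v u ⟩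
        ∏ᴷ v * ∏ᴷ u                 ∎
      where
        open ≡-Reasoning
        aa⁻¹ : a * a⁻¹ ≡ 1#
        aa⁻¹ = proj₂ (inverse a a≢0)

    fermat-nonzero : a ^ᶠ (n ∸ 1) ≡ 1#
    fermat-nonzero = begin
        a ^ᶠ (n ∸ 1)  ≡⟨ sym (∏ᴷ-all-but-zero v (ifZero-0 refl) (λ z z≢0 → ifZero-≢ z≢0)) ⟩
        ∏ᴷ v          ≡⟨ *-cancelʳ-nonzero (∏ᴷ-nonzero u u-nonzero) (trans (sym ∏u≡∏v*∏u) (sym (*-identityˡ _))) ⟩
        1#            ∎
      where open ≡-Reasoning

  fermat : ∀ {a} → a ≢ 0# → a ^ᶠ (n ∸ 1) ≡ 1#
  fermat a≢0 = Fermat.fermat-nonzero a≢0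

  fermat-all : ∀ z y → z ^ᶠ suc (y ℕ.* (n ∸ 1)) ≡ z
  fermat-all z y with z ≟ 0#
  ... | yes z≡0 = trans (cong (_^ᶠ suc (y ℕ.* (n ∸ 1))) z≡0) (trans (zeroˡ _) (sym z≡0))
  ... | no z≢0  = begin
      z * z ^ᶠ (y ℕ.* (n ∸ 1))    ≡⟨ cong (λ m → z * z ^ᶠ m) (ℕₚ.*-comm y (n ∸ 1)) ⟩
      z * z ^ᶠ ((n ∸ 1) ℕ.* y)    ≡⟨ cong (z *_) (sym (^-assocʳ z (n ∸ 1) y)) ⟩
      z * (z ^ᶠ (n ∸ 1)) ^ᶠ y     ≡⟨ cong (λ w → z * w ^ᶠ y) (fermat z≢0) ⟩
      z * 1# ^ᶠ y                 ≡⟨ cong (z *_) (1^n≡1 y) ⟩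
      z * 1#                      ≡⟨ *-identityʳ z ⟩
      z                           ∎
    where open ≡-Reasoning

-- In a field with n elements, z ↦ z ^ e is injective when e ≥ 1 is coprime
-- to n - 1: a Bézout identity for e and n - 1 turns Fermat's theorem into an
-- inverse of the power map (on nonzero elements, in the second Bézout case).
module PowerMaps {n : ℕ} (L : FiniteField n) where
  open FieldArithmetic (FiniteField.field′ L)
  open FiniteFieldFacts L using (_≟_; fermat; fermat-all)

  ^-zero⇒zero : ∀ {z} e → z ^ᶠ e ≡ 0# → z ≡ 0#
  ^-zero⇒zero {z} e zᵉ≡0 with z ≟ 0#
  ... | yes z≡0 = z≡0
  ... | no z≢0  = ⊥-elim (^-nonzero e z≢0 zᵉ≡0)

  0^e≡0 : ∀ {e} → 1 ≤ e → 0# ^ᶠ e ≡ 0#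
  0^e≡0 (s≤s _) = zeroˡ _

  power-inverts : ∀ {e} H → suc e ≡ (n ∸ 1) ℕ.* H → ∀ c → c ≢ 0# → c * c ^ᶠ e ≡ 1#
  power-inverts {e} H 1+e≡[n-1]H c c≢0 = begin
      c ^ᶠ suc e               ≡⟨ cong (c ^ᶠ_) 1+e≡[n-1]H ⟩
      c ^ᶠ ((n ∸ 1) ℕ.* H)     ≡⟨ sym (^-assocʳ c (n ∸ 1) H) ⟩
      (c ^ᶠ (n ∸ 1)) ^ᶠ H      ≡⟨ cong (_^ᶠ H) (fermat c≢0) ⟩
      1# ^ᶠ H                  ≡⟨ 1^n≡1 H ⟩
      1#                       ∎
    where open ≡-Reasoning

  power-injective : ∀ e → 1 ≤ e → Coprime e (n ∸ 1) → Injective _≡_ _≡_ (_^ᶠ e)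
  power-injective e e≥1 e⊥n-1 {z} {w} zᵉ≡wᵉ with coprime-Bézout e⊥n-1
  ... | Bézout.+- x y 1+y[n-1]≡xe = begin
      z                        ≡⟨ sym (root z) ⟩
      (z ^ᶠ e) ^ᶠ x            ≡⟨ cong (_^ᶠ x) zᵉ≡wᵉ ⟩
      (w ^ᶠ e) ^ᶠ x            ≡⟨ root w ⟩
      w                        ∎
    where
      open ≡-Reasoning
      root : ∀ z → (z ^ᶠ e) ^ᶠ x ≡ z
      root z = trans (^-assocʳ z e x)
        (trans (cong (z ^ᶠ_) (trans (ℕₚ.*-comm e x) (sym 1+y[n-1]≡xe))) (fermat-all z y))
  ... | Bézout.-+ x y 1+xe≡y[n-1] with z ≟ 0# | w ≟ 0#
  ...   | yes z≡0 | _       = trans z≡0 (sym (^-zero⇒zero e (trans (sym zᵉ≡wᵉ) (trans (cong (_^ᶠ e) z≡0) (0^e≡0 e≥1)))))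
  ...   | no z≢0  | yes w≡0 = ⊥-elim (z≢0 (^-zero⇒zero e (trans zᵉ≡wᵉ (trans (cong (_^ᶠ e) w≡0) (0^e≡0 e≥1)))))
  ...   | no z≢0  | no w≢0  = inverse-unique
      (trans (*-comm _ z) (inverse-of z≢0))
      (trans (cong (λ s → s ^ᶠ x * w) zᵉ≡wᵉ) (trans (*-comm _ w) (inverse-of w≢0)))
    where
      inverse-of : ∀ {z} → z ≢ 0# → z * (z ^ᶠ e) ^ᶠ x ≡ 1#
      inverse-of {z} z≢0 = begin
          z * (z ^ᶠ e) ^ᶠ x        ≡⟨ cong (z *_) (^-assocʳ z e x) ⟩
          z ^ᶠ suc (e ℕ.* x)       ≡⟨ cong (λ m → z ^ᶠ suc m) (ℕₚ.*-comm e x) ⟩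
          z ^ᶠ suc (x ℕ.* e)       ≡⟨ cong (z ^ᶠ_) 1+xe≡y[n-1] ⟩
          z ^ᶠ (y ℕ.* (n ∸ 1))     ≡⟨ cong (z ^ᶠ_) (ℕₚ.*-comm y (n ∸ 1)) ⟩
          z ^ᶠ ((n ∸ 1) ℕ.* y)     ≡⟨ sym (^-assocʳ z (n ∸ 1) y) ⟩
          (z ^ᶠ (n ∸ 1)) ^ᶠ y      ≡⟨ cong (_^ᶠ y) (fermat z≢0) ⟩
          1# ^ᶠ y                  ≡⟨ 1^n≡1 y ⟩
          1#                       ∎
        where open ≡-Reasoning

module Exponent (s : ℕ) where
  open import Data.Nat using (_+_; _*_)
  open ≡-Reasoning

  r b q : ℕ
  r = suc s
  b = suc r
  q = suc b

  G : ℕ → ℕ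
  G zero    = 0
  G (suc m) = q ^ m + G m

  e : ℕ
  e = G r

  e-positive : 1 ≤ e
  e-positive = ℕₚ.≤-trans (ℕₚ.m^n>0 q s) (ℕₚ.m≤m+n (q ^ s) (G s))

  power-of-successor : ∀ c m → Σ ℕ λ J → suc c ^ m ≡ 1 + c * J
  power-of-successor c zero    = 0 , cong suc (sym (ℕₚ.*-zeroʳ c))
  power-of-successor c (suc m) with power-of-successor c m
  ... | J , eq = 1 + J + c * J , trans (cong (suc c *_) eq) (expand c J)
    where
      expand : ∀ c J → suc c * (1 + c * J) ≡ 1 + c * (1 + J + c * J)
      expand = solve-∀

  geometric-sum : ∀ m → G m * b + 1 ≡ q ^ m
  geometric-sum zero    = refl
  geometric-sum (suc m) = begin
      (q ^ m + G m) * b + 1   ≡⟨ regroup (q ^ m) (G m) b ⟩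
      q ^ m * b + (G m * b + 1) ≡⟨ cong (q ^ m * b +_) (geometric-sum m) ⟩
      q ^ m * b + q ^ m       ≡⟨ factor (q ^ m) b ⟩
      suc b * q ^ m           ∎
    where
      regroup : ∀ x y b → (x + y) * b + 1 ≡ x * b + (y * b + 1)
      regroup = solve-∀
      factor : ∀ x b → x * b + x ≡ suc b * x
      factor = solve-∀

  -- G m ≡ m (mod q - 1), since every power of q is ≡ 1.
  geometric-sum-mod : ∀ m → Σ ℕ λ H → G m ≡ m + b * H
  geometric-sum-mod zero = 0 , sym (ℕₚ.*-zeroʳ b)
  geometric-sum-mod (suc m) with geometric-sum-mod m | power-of-successor b m
  ... | H , G≡ | J , qᵐ≡ = J + H , trans (cong₂ _+_ qᵐ≡ G≡) (regroup m b J H)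
    where
      regroup : ∀ m b J H → (1 + b * J) + (m + b * H) ≡ suc m + b * (J + H)
      regroup = solve-∀

  e-inverse-exponent : Σ ℕ λ H → suc e ≡ b * H
  e-inverse-exponent with geometric-sum-mod r
  ... | H , e≡ = suc H , trans (cong suc e≡) (sym (ℕₚ.*-suc b H))

  -- q ^ (1 + t r) - 1 ≡ q - 1 (mod e), because q ^ r ≡ 1 (mod e).
  order-of-q : ∀ t → Σ ℕ λ X → q ^ suc (t * r) ≡ suc (b + e * X)
  order-of-q t with power-of-successor (e * b) t
  ... | J , eq = q * (b * J) , (begin
      q * q ^ (t * r)          ≡⟨ cong (q *_) (trans (cong (q ^_) (ℕₚ.*-comm t r)) (sym (ℕₚ.^-*-assoc q r t))) ⟩
      q * (q ^ r) ^ t          ≡⟨ cong (λ z → q * z ^ t) (sym (trans (ℕₚ.+-comm 1 (e * b)) (geometric-sum r))) ⟩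
      q * suc (e * b) ^ t      ≡⟨ cong (q *_) eq ⟩
      q * (1 + e * b * J)      ≡⟨ expand b e J ⟩
      suc (b + e * (q * (b * J))) ∎)
    where
      expand : ∀ b e J → suc b * (1 + e * b * J) ≡ suc (b + e * (suc b * (b * J)))
      expand = solve-∀

  -- A common divisor d of e and q ^ (1 + t r) - 1 divides q - 1 = r + 1, hence
  -- r (as e ≡ r mod q - 1), hence 1.
  e-coprime : ∀ t → Coprime e (q ^ suc (t * r) ∸ 1)
  e-coprime t {d} (d∣e , d∣qᵏ-1) with order-of-q t | geometric-sum-mod r
  ... | X , qᵏ≡ | H , e≡ = ∣1⇒≡1 d∣1
    where
      d∣b : d ∣ b
      d∣b = ∣m+n∣m⇒∣n (subst (d ∣_) (ℕₚ.+-comm b (e * X)) (subst (λ z → d ∣ z ∸ 1) qᵏ≡ d∣qᵏ-1)) (∣m⇒∣m*n X d∣e)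
      d∣r : d ∣ r
      d∣r = ∣m+n∣m⇒∣n (subst (d ∣_) (trans e≡ (ℕₚ.+-comm r (b * H))) d∣e) (∣m⇒∣m*n H d∣b)
      d∣1 : d ∣ 1
      d∣1 = ∣m+n∣m⇒∣n (subst (d ∣_) (ℕₚ.+-comm 1 r) d∣b) d∣r

-- If H inverts every nonzero element and fixes 0, then
-- T = S ∘ H ∘ S ∘ H ∘ S ∘ H with S c = 1 - c is the transposition of 0 and 1.
-- For c ∉ {0, 1} the successive values are 1/c, (c-1)/c, c/(c-1),
-- -1/(c-1), 1-c and finally c.
module Carlitz (F : Field) (H : Field.Carrier F → Field.Carrier F)
               (H-0 : H (Field.0# F) ≡ Field.0# F)
               (H-inverse : ∀ c → c ≢ Field.0# F → Field._*_ F c (H c) ≡ Field.1# F) where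
  open FieldArithmetic F

  S : Carrier → Carrier
  S c = 1# - c

  S-0 : S 0# ≡ 1#
  S-0 = trans (cong (1# +_) -0#≈0#) (+-identityʳ 1#)

  S-1 : S 1# ≡ 0#
  S-1 = -‿inverseʳ 1#

  H-1 : H 1# ≡ 1#
  H-1 = trans (sym (*-identityˡ _)) (H-inverse 1# 1≢0)

  T : Carrier → Carrier
  T c = S (H (S (H (S (H c)))))

  T-0 : T 0# ≡ 1#
  T-0 rewrite H-0 | S-0 | H-1 | S-1 | H-0 | S-0 = refl

  T-1 : T 1# ≡ 0#
  T-1 rewrite H-1 | S-1 | H-0 | S-0 | H-1 | S-1 = refl

  sub-cancel : ∀ a b → (a - b) - a ≡ - b
  sub-cancel a b = begin
      (a + - b) + - a  ≡⟨ cong (_+ - a) (+-comm a (- b)) ⟩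
      (- b + a) + - a  ≡⟨ +-assoc (- b) a (- a) ⟩
      - b + (a + - a)  ≡⟨ cong (- b +_) (-‿inverseʳ a) ⟩
      - b + 0#         ≡⟨ +-identityʳ (- b) ⟩
      - b              ∎
    where open ≡-Reasoning

  T-other : ∀ {c} → c ≢ 0# → c ≢ 1# → T c ≡ c
  T-other {c} c≢0 c≢1 = begin
      S k      ≡⟨ cong S (inverse-unique zk≡1 z[1-c]≡1) ⟩
      S (S c)  ≡⟨ sub-sub 1# c ⟩
      c        ∎
    where
      open ≡-Reasoning
      i y j z k : Carrier
      i = H c
      y = S i
      j = H y
      z = S j
      k = H z
      ci≡1 : c * i ≡ 1#
      ci≡1 = H-inverse c c≢0
      y≢0 : y ≢ 0#
      y≢0 y≡0 = c≢1 (trans (sym (*-identityʳ c)) (trans (cong (c *_) (x∙y⁻¹≈ε⇒x≈y 1# i y≡0)) ci≡1))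
      yj≡1 : y * j ≡ 1#
      yj≡1 = H-inverse y y≢0
      z≢0 : z ≢ 0#
      z≢0 z≡0 = invertible-right ci≡1 i≡0
        where
          y≡1 : y ≡ 1#
          y≡1 = trans (sym (*-identityʳ y)) (trans (cong (y *_) (x∙y⁻¹≈ε⇒x≈y 1# j z≡0)) yj≡1)
          i≡0 : i ≡ 0#
          i≡0 = trans (sym (sub-sub 1# i)) (trans (cong S y≡1) S-1)
      zk≡1 : z * k ≡ 1#
      zk≡1 = H-inverse z z≢0
      yz≡-i : y * z ≡ - i
      yz≡-i = begin
          y * (1# - j)         ≡⟨ x[y-z]≈xy-xz y 1# j ⟩
          y * 1# - y * j       ≡⟨ cong₂ _-_ (*-identityʳ y) yj≡1 ⟩
          (1# - i) - 1#        ≡⟨ sub-cancel 1# i ⟩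
          - i                  ∎
      -i[1-c]≡y : - i * (1# - c) ≡ y
      -i[1-c]≡y = begin
          - i * (1# - c)       ≡⟨ sym (-‿distribˡ-* i (1# - c)) ⟩
          - (i * (1# - c))     ≡⟨ cong -_ (x[y-z]≈xy-xz i 1# c) ⟩
          - (i * 1# - i * c)   ≡⟨ cong -_ (cong₂ _-_ (*-identityʳ i) (trans (*-comm i c) ci≡1)) ⟩
          - (i - 1#)           ≡⟨ ⁻¹-anti-homo‿- i 1# ⟩
          1# - i               ∎
      z[1-c]≡1 : z * S c ≡ 1#
      z[1-c]≡1 = *-cancelˡ-nonzero y≢0 (begin
          y * (z * S c)        ≡⟨ sym (*-assoc y z (S c)) ⟩
          (y * z) * S c        ≡⟨ cong (_* S c) yz≡-i ⟩
          - i * S c            ≡⟨ -i[1-c]≡y ⟩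
          y                    ≡⟨ sym (*-identityʳ y) ⟩
          y * 1#               ∎)

-- The affine chart sending a ≠ b to 0 and 1: B c = (c - a)/(b - a), written
-- as - a δ + c δ with δ = (b - a)⁻¹, and its inverse A c = a + c (b - a).
module AffineChart (F : Field) {a b : Field.Carrier F} (a≢b : a ≢ b) where
  open FieldArithmetic F
  open import Algebra.Solver.Ring.NaturalCoefficients.Default commutativeSemiring
    using (solve; _:=_; _:+_; _:*_)
  open ≡-Reasoning

  d δ : Carrier
  d = b - a

  d≢0 : d ≢ 0#
  d≢0 d≡0 = a≢b (sym (x∙y⁻¹≈ε⇒x≈y b a d≡0))

  δ = proj₁ (inverse d d≢0)

  dδ≡1 : d * δ ≡ 1#
  dδ≡1 = proj₂ (inverse d d≢0)

  δ≢0 : δ ≢ 0#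
  δ≢0 = invertible-right dδ≡1

  A B : Carrier → Carrier
  A c = a + c * d
  B c = - a * δ + c * δ

  A∘B≡id : ∀ c → A (B c) ≡ c
  A∘B≡id c = begin
      a + (- a * δ + c * δ) * d           ≡⟨ regroup a (- a) δ c d ⟩
      (a + - a * (d * δ)) + c * (d * δ)   ≡⟨ cong (λ w → (a + - a * w) + c * w) dδ≡1 ⟩
      (a + - a * 1#) + c * 1#             ≡⟨ cong₂ (λ u w → (a + u) + w) (*-identityʳ _) (*-identityʳ c) ⟩
      (a + - a) + c                       ≡⟨ cong (_+ c) (-‿inverseʳ a) ⟩
      0# + c                              ≡⟨ +-identityˡ c ⟩
      c                                   ∎
    where
      regroup : ∀ a na δ c d → a + (na * δ + c * δ) * d ≡ (a + na * (d * δ)) + c * (d * δ)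
      regroup = solve 5 (λ a na δ c d →
        a :+ (na :* δ :+ c :* δ) :* d := (a :+ na :* (d :* δ)) :+ c :* (d :* δ)) refl

  B-injective : ∀ {c c′} → B c ≡ B c′ → c ≡ c′
  B-injective {c} {c′} eq = trans (sym (A∘B≡id c)) (trans (cong A eq) (A∘B≡id c′))

  B-a : B a ≡ 0#
  B-a = trans (sym (distribʳ δ (- a) a)) (trans (cong (_* δ) (-‿inverseˡ a)) (zeroˡ δ))

  B-b : B b ≡ 1#
  B-b = trans (sym (distribʳ δ (- a) b)) (trans (cong (_* δ) (+-comm (- a) b)) dδ≡1)

module GoodMaps {n : ℕ} (K : FiniteField n) (size : ℕ → ℕ) where
  private
    K′ : Field
    K′ = FiniteField.field′ K
  open FieldArithmetic K′
  open Polynomials K′ using (⟦_⟧; _⊚_; monomial; eval-⊚; eval-monomial; eval-linear)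
  open FiniteFieldFacts K
    using (_≟_; to; from; from-to; asPermutation; induced; induced-∘; induced-transpose;
           swap; swap-left; swap-right; swap-other; swap-trivial)

  PermutesExtensions : Poly K′ → Set₁
  PermutesExtensions f = ∀ t (L : FiniteField (size t)) (φ : Carrier → FiniteField.Carrier L) →
    IsFieldHom K′ (FiniteField.field′ L) φ →
    Injective _≡_ _≡_ (eval (FiniteField.field′ L) (mapPoly K′ (FiniteField.field′ L) φ f))

  Good : (Carrier → Carrier) → Set₁
  Good g = Σ (Poly K′) λ f → (∀ c → ⟦ f ⟧ c ≡ g c) × PermutesExtensions f

  good-ext : ∀ {g h} → Good g → (∀ c → g c ≡ h c) → Good h
  good-ext (f , f≡g , f-perm) g≡h = f , (λ c → trans (f≡g c) (g≡h c)) , f-perm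

  good-∘ : ∀ {g h} → Good g → Good h → Good (λ c → g (h c))
  good-∘ {g} {h} (f₁ , f₁≡g , f₁-perm) (f₂ , f₂≡h , f₂-perm) =
    f₁ ⊚ f₂ , (λ c → trans (eval-⊚ f₁ f₂ c) (trans (cong ⟦ f₁ ⟧ (f₂≡h c)) (f₁≡g (h c)))) , perm
    where
      perm : PermutesExtensions (f₁ ⊚ f₂)
      perm t L φ φ-hom {y} {z} eq = f₂-perm t L φ φ-hom (f₁-perm t L φ φ-hom
          (trans (sym (eval-map-⊚ f₁ f₂ y)) (trans eq (eval-map-⊚ f₁ f₂ z))))
        where open PolynomialsUnderEmbedding K′ (FiniteField.field′ L) φ φ-hom using (eval-map-⊚)

  good-affine : ∀ β {α} → α ≢ 0# → Good (λ c → β + c * α)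
  good-affine β {α} α≢0 = β ∷ α ∷ [] , eval-linear β α , perm
    where
      perm : PermutesExtensions (β ∷ α ∷ [])
      perm t L φ φ-hom {y} {z} eq =
        L.*-cancelʳ-nonzero (φ-nonzero α≢0) (L.+-cancelˡ (φ β) _ _
          (trans (sym (PL.eval-linear (φ β) (φ α) y)) (trans eq (PL.eval-linear (φ β) (φ α) z))))
        where
          module L = FieldArithmetic (FiniteField.field′ L)
          module PL = Polynomials (FiniteField.field′ L)
          open PolynomialsUnderEmbedding K′ (FiniteField.field′ L) φ φ-hom using (φ-nonzero)

  good-id : Good (λ c → c)
  good-id = good-ext (good-affine 0# 1≢0) (λ c → trans (+-identityˡ _) (*-identityʳ c))

  good-power : ∀ e → 1 ≤ e → (∀ t → Coprime e (size t ∸ 1)) → Good (_^ᶠ e)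
  good-power e e≥1 e-coprime = monomial e , eval-monomial e , perm
    where
      perm : PermutesExtensions (monomial e)
      perm t L φ φ-hom {y} {z} eq = PowerMaps.power-injective L e e≥1 (e-coprime t)
          (trans (sym (eval-map-monomial e y)) (trans eq (eval-map-monomial e z)))
        where open PolynomialsUnderEmbedding K′ (FiniteField.field′ L) φ φ-hom using (eval-map-monomial)

  module Generation (H : Carrier → Carrier) (H-0 : H 0# ≡ 0#)
                    (H-inverse : ∀ c → c ≢ 0# → c * H c ≡ 1#) (good-H : Good H) where
    open Carlitz K′ H H-0 H-inverse using (S; T; T-0; T-1; T-other)

    good-S : Good S
    good-S = good-ext (good-affine 1# -1≢0) λ c → cong (1# +_) (trans (*-comm c (- 1#)) (-1*x≈-x c))
      where
        -1≢0 : - 1# ≢ 0#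
        -1≢0 -1≡0 = 1≢0 (trans (sym (-‿involutive 1#)) (trans (cong -_ -1≡0) -0#≈0#))

    good-T : Good T
    good-T = good-∘ good-S (good-∘ good-H (good-∘ good-S (good-∘ good-H (good-∘ good-S good-H))))

    -- The transposition of a ≠ b is A ∘ T ∘ B in the affine chart of a and b.
    good-swap : ∀ a b → Good (swap a b)
    good-swap a b with a ≟ b
    ... | yes a≡b = good-ext good-id (swap-trivial a≡b)
    ... | no a≢b  = good-ext (good-∘ (good-affine a d≢0) (good-∘ good-T (good-affine (- a * δ) δ≢0))) A∘T∘B≡swap
      where
        open AffineChart K′ a≢b
        A∘T∘B≡swap : ∀ c → A (T (B c)) ≡ swap a b c
        A∘T∘B≡swap c with c ≟ a | c ≟ b
        ... | yes refl | _        = trans (cong (λ w → A (T w)) B-a)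
            (trans (cong A (trans T-0 (sym B-b))) (trans (A∘B≡id b) (sym (swap-left a b))))
        ... | no _     | yes refl = trans (cong (λ w → A (T w)) B-b)
            (trans (cong A (trans T-1 (sym B-a))) (trans (A∘B≡id a) (sym (swap-right a b))))
        ... | no c≢a   | no c≢b   = trans (cong A (T-other Bc≢0 Bc≢1)) (trans (A∘B≡id c) (sym (swap-other c≢a c≢b)))
          where
            Bc≢0 : B c ≢ 0#
            Bc≢0 Bc≡0 = c≢a (B-injective (trans Bc≡0 (sym B-a)))
            Bc≢1 : B c ≢ 1#
            Bc≢1 Bc≡1 = c≢b (B-injective (trans Bc≡1 (sym B-b)))

    good-transpositions : ∀ xs → Good (induced (Transpositions.eval xs))
    good-transpositions [] = good-ext good-id (λ c → sym (from-to c))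
    good-transpositions ((i , j) ∷ xs) =
      good-ext (good-∘ (good-transpositions xs) (good-swap (from i) (from j))) λ c → begin
        induced (Transpositions.eval xs) (swap (from i) (from j) c)
          ≡⟨ cong (induced (Transpositions.eval xs)) (sym (induced-transpose i j c)) ⟩
        induced (Transpositions.eval xs) (induced (transpose i j) c)
          ≡⟨ sym (induced-∘ (transpose i j) (Transpositions.eval xs) c) ⟩
        induced (transpose i j ∘ₚ Transpositions.eval xs) c ∎
      where open ≡-Reasoning

    -- Every permutation of K is a product of transpositions, hence good.
    good-permutation : ∀ σ → Bijective _≡_ _≡_ σ → Good σ
    good-permutation σ (σ-injective , σ-surjective) =
      good-ext (good-transpositions (Transpositions.decompose π)) λ c → begin
        induced (Transpositions.eval (Transpositions.decompose π)) c
          ≡⟨ cong from (Transpositions.eval-decompose π (to c)) ⟩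
        from (to (σ (from (to c))))
          ≡⟨ trans (from-to _) (cong σ (from-to c)) ⟩
        σ c ∎
      where
        open ≡-Reasoning
        σ⁻¹ : Carrier → Carrier
        σ⁻¹ y = proj₁ (σ-surjective y)
        σσ⁻¹ : ∀ y → σ (σ⁻¹ y) ≡ y
        σσ⁻¹ y = proj₂ (σ-surjective y) refl
        π : Permutation′ n
        π = asPermutation σ σ⁻¹ σσ⁻¹ (λ x → σ-injective (σσ⁻¹ (σ x)))

-- The theorem: for q = s + 3, every permutation σ of K is good for the sizes
-- q ^ (1 + t (s + 1)), using x ^ e as the good inversion; the polynomial
-- inducing σ is injective, hence bijective, on each field of such a size.
mainTheorem2 : (q : ℕ) → Σ ℕ (λ p → Σ ℕ (λ m → Prime p × q ≡ p ^ m)) → 2 < q →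
    (K : FiniteField q) →
    (σ : FiniteField.Carrier K → FiniteField.Carrier K) → Bijective _≡_ _≡_ σ →
    Σ (Poly (FiniteField.field′ K)) (λ f →
      ((c : FiniteField.Carrier K) → eval (FiniteField.field′ K) f c ≡ σ c) ×
      ((N : ℕ) → Σ ℕ (λ k → N < k ×
        ((L : FiniteField (q ^ k)) →
         (φ : FiniteField.Carrier K → FiniteField.Carrier L) →
         IsFieldHom (FiniteField.field′ K) (FiniteField.field′ L) φ →
         Bijective _≡_ _≡_
           (eval (FiniteField.field′ L) (mapPoly (FiniteField.field′ K) (FiniteField.field′ L) φ f))))))
mainTheorem2 (suc (suc (suc s))) _ (s≤s (s≤s (s≤s _))) K σ σ-bijective =
  f , f≡σ , λ N → suc (N ℕ.* r) , s≤s (ℕₚ.m≤m*n N r) ,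
    λ L φ φ-hom → FiniteFieldFacts.injective⇒bijective L (f-on L φ) (f-injective N L φ φ-hom)
  where
    open Exponent s using (r; e; e-positive; e-inverse-exponent; e-coprime)
    open GoodMaps K (λ t → suc (suc (suc s)) ^ suc (t ℕ.* r))
      using (Good; PermutesExtensions; module Generation; good-power)
    open PowerMaps K using (0^e≡0; power-inverts)
    open FieldArithmetic (FiniteField.field′ K) using (_^ᶠ_)
    open Generation (_^ᶠ e) (0^e≡0 e-positive)
      (power-inverts (proj₁ e-inverse-exponent) (proj₂ e-inverse-exponent))
      (good-power e e-positive e-coprime)
    σ-good : Good σ
    σ-good = good-permutation σ σ-bijective
    f : Poly (FiniteField.field′ K)
    f = proj₁ σ-good
    f≡σ : ∀ c → eval (FiniteField.field′ K) f c ≡ σ c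
    f≡σ = proj₁ (proj₂ σ-good)
    f-injective : PermutesExtensions f
    f-injective = proj₂ (proj₂ σ-good)
    f-on : ∀ {m} (L : FiniteField m) → (FiniteField.Carrier K → FiniteField.Carrier L) →
      FiniteField.Carrier L → FiniteField.Carrier L
    f-on L φ = eval (FiniteField.field′ L) (mapPoly (FiniteField.field′ K) (FiniteField.field′ L) φ f)
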